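{- Let $k\geqslant 1$ be an integer, let $G=(V,E)$ be a minor-minimal non-$k$-graph, let $\langle c,x\rangle\geqslant k$ be a witness for $G$, and let $\mathcal F$ be a laminar family of subsets of $V$ such that $\{\delta(S):S\in\mathcal F\}$ is a basis of minimum cuts. Then every level-$0$ set of $\mathcal F$ (i.e. every inclusionwise minimal member of $\mathcal F$) is a singleton.
   Context: Graphs are finite, undirected, may have loops and parallel edges, and have at least two nodes. For $S\subseteq V$, $\delta(S)$ is the set of edges with exactly one endnode in $S$; $\chi^F$ is the characteristic vector of $F\subseteq E$ and $c(F)=\sum_{e\in F}c(e)$. The cut dominant is $\mathrm{CUT}(G)=\mathrm{conv}\{\chi^{\delta(S)} : \varnothing\neq S\subsetneq V\}+\mathbb{R}^E_+$. Each facet-defining inequality has a unique minimum integer form with relatively prime integer coefficients and right-hand side. $G$ is a $k$-graph if every facet-defining inequality of $\mathrm{CUT}(G)$ in minimum integer form has right-hand side at most $k$; $k^*(G)$ is the least such $k$. $G$ is a minor-minimal non-$k$-graph if $k^*(G)>k$ and $k^*(G')\leqslant k$ for every proper minor $G'$. A witness is a facet-defining inequality $\langle c,x\rangle\geqslant k$ of $\mathrm{CUT}(G)$ whose minimum integer form has right-hand side $>k$. A minimum cut is a cut $\delta(S)$, $\varnothing\neq S\subsetneq V$, minimizing $c(\delta(S))$. "$\{\delta(S):S\in\mathcal F\}$ is a basis of minimum cuts" means $\mathcal F$ consists of $|E|$ sets $S$ with $\varnothing\neq S\subsetneq V$, each $\delta(S)$ a minimum cut, with the vectors $\chi^{\delta(S)}$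 linearly independent. A family is laminar if any two members are disjoint or comparable under inclusion.
   Formalization: The witness c, the points of CUT(G) and the facet-defining inequalities tested in the k-graph condition have rational coordinates or coefficients rather than real ones. -}

module Defs where

open import Data.Nat as ℕ using (ℕ; zero; suc)
open import Data.Nat.Divisibility using (_∣_)
open import Data.Integer as ℤ using (ℤ; +_; ∣_∣)
open import Data.Rational using (ℚ; 0ℚ; 1ℚ; _+_; _*_; _≤_; _<_; _/_)
open import Data.Fin using (Fin; zero; suc; punchIn; punchOut; _≟_)
open import Data.Bool using (Bool; true; false; if_then_else_; _xor_)
open import Data.Product using (Σ; ∃; ∃-syntax; _×_; _,_; proj₁; proj₂)
open import Data.Sum using (_⊎_)
open import Relation.Binary.PropositionalEquality using (_≡_; _≢_; sym)
open import Relation.Nullary using (¬_; yes; no)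

Σℚ : ∀ {r} → (Fin r → ℚ) → ℚ
Σℚ {zero}  f = 0ℚ
Σℚ {suc r} f = f zero + Σℚ (λ i → f (suc i))

ℤtoℚ : ℤ → ℚ
ℤtoℚ z = z / 1

ℕtoℚ : ℕ → ℚ
ℕtoℚ n = (+ n) / 1

-- Graphs: finite, undirected, loops and parallel edges allowed,
-- at least two nodes.  Nodes Fin n, edges Fin m, each edge has two ends.

record Graph : Set where
  constructor mkG
  field
    n        : ℕ
    m        : ℕ
    ends     : Fin m → Fin n × Fin n
    twoNodes : 2 ℕ.≤ n
open Graph public

VSet : ℕ → Set
VSet n = Fin n → Bool

_⊆ᵥ_ : ∀ {n} → VSet n → VSet n → Set
S ⊆ᵥ T = ∀ v → S v ≡ true → T v ≡ true

Disjoint : ∀ {n} → VSet n → VSet n → Set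
Disjoint S T = ∀ v → ¬ (S v ≡ true × T v ≡ true)

NonTrivial : ∀ {n} → VSet n → Set
NonTrivial S = (∃[ u ] S u ≡ true) × (∃[ v ] S v ≡ false)

Singleton : ∀ {n} → VSet n → Set
Singleton S = ∃[ v ] (S v ≡ true × (∀ w → S w ≡ true → w ≡ v))

inCut : (G : Graph) → VSet (n G) → Fin (m G) → Bool
inCut G S e = S (proj₁ (ends G e)) xor S (proj₂ (ends G e))

χδ : (G : Graph) → VSet (n G) → Fin (m G) → ℚ
χδ G S e = if inCut G S e then 1ℚ else 0ℚ

dot : ∀ {m} → (Fin m → ℚ) → (Fin m → ℚ) → ℚ
dot a x = Σℚ (λ e → a e * x e)

cutWeight : (G : Graph) → (Fin (m G) → ℚ) → VSet (n G) → ℚ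
cutWeight G c S = dot c (χδ G S)

-- The cut dominant CUT(G) = conv{χ^{δ(S)}} + ℝ^E_+  (rational points)

InCUT : (G : Graph) → (Fin (m G) → ℚ) → Set
InCUT G x =
  Σ ℕ λ r → Σ (Fin r → VSet (n G)) λ S → Σ (Fin r → ℚ) λ λs →
    (∀ i → NonTrivial (S i)) × (∀ i → 0ℚ ≤ λs i) × (Σℚ λs ≡ 1ℚ) ×
    (∀ e → Σℚ (λ i → λs i * χδ G (S i) e) ≤ x e)

-- ⟨c,x⟩ ≥ β is facet-defining for CUT(G): valid, c ≠ 0, and every affine
-- equation ⟨a,x⟩ = β' holding on the face {x ∈ CUT(G) : ⟨c,x⟩ = β} is a
-- scalar multiple of ⟨c,x⟩ = β (i.e. the face has dimension |E| - 1 =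
-- dim CUT(G) - 1, CUT(G) being full-dimensional).
FacetDefining : (G : Graph) → (Fin (m G) → ℚ) → ℚ → Set
FacetDefining G c β =
  (∀ x → InCUT G x → β ≤ dot c x) ×
  (∃[ e ] c e ≢ 0ℚ) ×
  (∀ (a : Fin (m G) → ℚ) (β' : ℚ) →
     (∀ x → InCUT G x → dot c x ≡ β → dot a x ≡ β') →
     ∃[ t ] ((∀ e → a e ≡ t * c e) × β' ≡ t * β))

RelPrime : ∀ {m} → (Fin m → ℤ) → ℤ → Set
RelPrime c' β' = ∀ d → (∀ e → d ∣ ∣ c' e ∣) → d ∣ ∣ β' ∣ → d ≡ 1

MinIntForm : ∀ {m} → (Fin m → ℚ) → ℚ → (Fin m → ℤ) → ℤ → Set
MinIntForm c β c' β' =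
  ∃[ t ] (0ℚ < t × (∀ e → ℤtoℚ (c' e) ≡ t * c e) × ℤtoℚ β' ≡ t * β ×
          RelPrime c' β')

KGraph : Graph → ℕ → Set
KGraph G k = ∀ c β → FacetDefining G c β →
  ∀ c' β' → MinIntForm c β c' β' → β' ℤ.≤ + k

-- contracting edge with ends (u , v), u ≠ v: v is merged into u
mergeMap : ∀ {n} (u v : Fin (suc n)) → u ≢ v → Fin (suc n) → Fin n
mergeMap u v u≢v w with v ≟ w
... | yes _   = punchOut {i = v} {j = u} (λ eq → u≢v (sym eq))
... | no v≢w = punchOut v≢w

mapPair : ∀ {A B : Set} → (A → B) → A × A → B × B
mapPair f (a , b) = f a , f b

-- single minor operations: delete an edge, contract a non-loop edge,
-- delete an isolated node (results must again have ≥ 2 nodes)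
data Step : Graph → Graph → Set where
  delEdge : ∀ {n m} (ends : Fin (suc m) → Fin n × Fin n) (p : 2 ℕ.≤ n)
    (e : Fin (suc m)) →
    Step (mkG n (suc m) ends p) (mkG n m (λ f → ends (punchIn e f)) p)
  conEdge : ∀ {n m} (ends : Fin (suc m) → Fin (suc n) × Fin (suc n))
    (p : 2 ℕ.≤ suc n) (e : Fin (suc m))
    (nl : proj₁ (ends e) ≢ proj₂ (ends e)) (p' : 2 ℕ.≤ n) →
    Step (mkG (suc n) (suc m) ends p)
         (mkG n m (λ f → mapPair (mergeMap (proj₁ (ends e)) (proj₂ (ends e)) nl)
                                 (ends (punchIn e f))) p')
  delNode : ∀ {n m} (ends : Fin m → Fin (suc n) × Fin (suc n))
    (p : 2 ℕ.≤ suc n) (v : Fin (suc n))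
    (iso : ∀ e → v ≢ proj₁ (ends e) × v ≢ proj₂ (ends e)) (p' : 2 ℕ.≤ n) →
    Step (mkG (suc n) m ends p)
         (mkG n m (λ e → punchOut (proj₁ (iso e)) , punchOut (proj₂ (iso e))) p')

data ProperMinor : Graph → Graph → Set where
  one  : ∀ {G H} → Step G H → ProperMinor H G
  more : ∀ {G H K} → Step G H → ProperMinor K H → ProperMinor K G

MinorMinimalNonK : Graph → ℕ → Set
MinorMinimalNonK G k = ¬ KGraph G k × (∀ H → ProperMinor H G → KGraph H k)

Witness : (G : Graph) → ℕ → (Fin (m G) → ℚ) → Set
Witness G k c = FacetDefining G c (ℕtoℚ k) ×
  ∃[ c' ] ∃[ β' ] (MinIntForm c (ℕtoℚ k) c' β' × + k ℤ.< β')

Laminar : ∀ {n r} → (Fin r → VSet n) → Set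
Laminar F = ∀ i j → Disjoint (F i) (F j) ⊎ (F i ⊆ᵥ F j ⊎ F j ⊆ᵥ F i)

MinimumCut : (G : Graph) → (Fin (m G) → ℚ) → VSet (n G) → Set
MinimumCut G c S = NonTrivial S ×
  (∀ T → NonTrivial T → cutWeight G c S ≤ cutWeight G c T)

BasisOfMinCuts : (G : Graph) → (Fin (m G) → ℚ) → (Fin (m G) → VSet (n G)) → Set
BasisOfMinCuts G c F =
  (∀ i → MinimumCut G c (F i)) ×
  (∀ (λs : Fin (m G) → ℚ) →
     (∀ e → Σℚ (λ i → λs i * χδ G (F i) e) ≡ 0ℚ) → ∀ i → λs i ≡ 0ℚ)

LevelZero : ∀ {n r} → (Fin r → VSet n) → Fin r → Set
LevelZero F i = ∀ j → F j ⊆ᵥ F i → F i ⊆ᵥ F j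

module Submission where

-- Let S = F i be a level-0 member of the laminar basis F.
-- (1) No edge has both endnodes in S: by laminarity and minimality every
--     member of F contains S or avoids it, so such an edge would lie in no
--     cut δ(F j); the |E| characteristic vectors χ^{δ(F j)} would then share
--     a zero coordinate and be dependent, contradicting that they form a
--     basis.  This uses the linear-algebra fact that |E| vectors of ℚ^E with
--     a common zero coordinate are dependent, proved by Gaussian elimination.
-- (2) Every cut has weight ≥ k > 0, since ⟨c,x⟩ ≥ k is valid for CUT(G).
--     If S, having no inner edge, contained nodes u ≠ w, then
--     c(δ(S)) = c(δ({u})) + c(δ(S - u)) > c(δ({u})), so δ(S) would not be
--     a minimum cut.  Hence S = {u}.

open import Defs
open import Data.Nat using (ℕ; _≤_)
open import Data.Fin using (Fin)
open import Data.Rational using (ℚ)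

open import Data.Nat as ℕ using (zero; suc; s≤s)
open import Data.Nat.Properties as ℕP using (≤-refl)
open import Data.Fin using (zero; suc; punchIn; punchOut; _≟_)
open import Data.Fin.Properties using (any?; punchIn-punchOut)
open import Data.Vec.Functional using (insertAt)
open import Data.Vec.Functional.Properties using (insertAt-lookup; insertAt-punchIn)
open import Data.Rational using (0ℚ; 1ℚ; _+_; _*_; -_; 1/_; _<_; NonZero; ≢-nonZero) renaming (_≤_ to _≤ℚ_)
open import Data.Rational.Properties as ℚP using (+-*-commutativeRing)
open import Data.Rational.Solver using (module +-*-Solver)
open import Algebra.Bundles using (CommutativeRing)
open import Algebra.Properties.Semiring.Sum (CommutativeRing.semiring +-*-commutativeRing)
  using (sum; sum-cong-≗; sum-remove; ∑-distrib-+; *-distribʳ-sum; sum-replicate-zero)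
open import Data.Bool using (Bool; true; false; if_then_else_; _xor_; _∧_; _∨_; not)
open import Data.Bool.Properties using (∧-identityʳ; ∧-zeroʳ; xor-same; ¬-not)
open import Data.Product using (Σ; ∃-syntax; _×_; _,_; proj₁; proj₂)
open import Data.Sum using (inj₁; inj₂)
open import Data.Empty using (⊥-elim)
open import Relation.Nullary using (¬_; yes; no; contradiction)
open import Relation.Nullary.Decidable using (¬?; does; dec-true; dec-false)
open import Relation.Binary.PropositionalEquality
open ≡-Reasoning

open +-*-Solver

Σℚ≡sum : ∀ {r} (f : Fin r → ℚ) → Σℚ f ≡ sum f
Σℚ≡sum {zero}  f = refl
Σℚ≡sum {suc r} f = cong (f zero +_) (Σℚ≡sum (λ i → f (suc i)))

combination : ∀ {p q} → (Fin p → ℚ) → (Fin p → Fin q → ℚ) → Fin q → ℚ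
combination l v c = sum (λ j → l j * v j c)

Dependent : ∀ {p q} → (Fin p → Fin q → ℚ) → Set
Dependent v = Σ (_ → ℚ) λ l → (∃[ j ] l j ≢ 0ℚ) × (∀ c → combination l v c ≡ 0ℚ)

dependent-dropZeroCoord : ∀ {p q} (v : Fin p → Fin (suc q) → ℚ) (c₀ : Fin (suc q)) →
  (∀ j → v j c₀ ≡ 0ℚ) → Dependent (λ j c → v j (punchIn c₀ c)) → Dependent v
dependent-dropZeroCoord {p} v c₀ zeroCoord (l , nonzero , rel) = l , nonzero , rel′
  where
  rel′ : ∀ c → combination l v c ≡ 0ℚ
  rel′ c with c₀ ≟ c
  ... | yes refl = begin
    sum (λ j → l j * v j c₀)  ≡⟨ sum-cong-≗ (λ j → trans (cong (l j *_) (zeroCoord j)) (ℚP.*-zeroʳ (l j))) ⟩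
    sum {p} (λ _ → 0ℚ)        ≡⟨ sum-replicate-zero p ⟩
    0ℚ                        ∎
  ... | no c₀≢c = subst (λ c′ → combination l v c′ ≡ 0ℚ) (punchIn-punchOut c₀≢c) (rel (punchOut c₀≢c))

-- One step of Gaussian elimination with pivot vector j₀ (whose first coordinate a is
-- nonzero): subtract from every other vector the multiple of v j₀ that
-- clears its first coordinate.
module Elimination {p q} (v : Fin (suc p) → Fin (suc q) → ℚ) (j₀ : Fin (suc p))
                   (a≢0 : v j₀ zero ≢ 0ℚ) where

  a : ℚ
  a = v j₀ zero

  instance
    a-nonZero : NonZero a
    a-nonZero = ≢-nonZero a≢0

  ratio : Fin p → ℚ
  ratio j = v (punchIn j₀ j) zero * 1/ a

  eliminated : Fin p → Fin (suc q) → ℚ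
  eliminated j c = v (punchIn j₀ j) c + - (ratio j * v j₀ c)

  eliminated-firstCoord : ∀ j → eliminated j zero ≡ 0ℚ
  eliminated-firstCoord j = begin
    x + - (x * 1/ a * a)    ≡⟨ cong (λ y → x + - y) (ℚP.*-assoc x (1/ a) a) ⟩
    x + - (x * (1/ a * a))  ≡⟨ cong (λ y → x + - (x * y)) (ℚP.*-inverseˡ a) ⟩
    x + - (x * 1ℚ)          ≡⟨ cong (λ y → x + - y) (ℚP.*-identityʳ x) ⟩
    x + - x                 ≡⟨ ℚP.+-inverseʳ x ⟩
    0ℚ                      ∎
    where x = v (punchIn j₀ j) zero

  -- A relation μ among the eliminated vectors gives one among the v j,
  -- by giving the pivot the coefficient that undoes the subtractions.
  lift : (Fin p → ℚ) → Fin (suc p) → ℚ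
  lift μ = insertAt μ j₀ (- sum (λ j → μ j * ratio j))

  combination-lift : ∀ μ c → combination (lift μ) v c ≡ combination μ eliminated c
  combination-lift μ c = begin
    sum (λ j → lift μ j * v j c)
      ≡⟨ sum-remove {i = j₀} (λ j → lift μ j * v j c) ⟩
    lift μ j₀ * z + sum (λ j → lift μ (punchIn j₀ j) * y j)
      ≡⟨ cong₂ _+_ (cong (_* z) (insertAt-lookup μ j₀ _))
                   (sum-cong-≗ (λ j → cong (_* y j) (insertAt-punchIn μ j₀ _ j))) ⟩
    - s * z + sum (λ j → μ j * y j)
      ≡⟨ solve 3 (λ s z m → (:- s) :* z :+ m := m :+ s :* (:- z)) refl s z _ ⟩
    sum (λ j → μ j * y j) + s * - z
      ≡⟨ cong (sum (λ j → μ j * y j) +_) (*-distribʳ-sum (- z) (λ j → μ j * ratio j)) ⟩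
    sum (λ j → μ j * y j) + sum (λ j → μ j * ratio j * - z)
      ≡⟨ ∑-distrib-+ (λ j → μ j * y j) (λ j → μ j * ratio j * - z) ⟨
    sum (λ j → μ j * y j + μ j * ratio j * - z)
      ≡⟨ sum-cong-≗ (λ j → solve 4 (λ m y r z → m :* y :+ m :* r :* (:- z) := m :* (y :+ :- (r :* z)))
                                    refl (μ j) (y j) (ratio j) z) ⟩
    sum (λ j → μ j * eliminated j c) ∎
    where
    z = v j₀ c
    y : Fin p → ℚ
    y j = v (punchIn j₀ j) c
    s = sum (λ j → μ j * ratio j)

  dependent-lift : Dependent eliminated → Dependent v
  dependent-lift (μ , (j₁ , μj₁≢0) , rel) =
    lift μ ,
    (punchIn j₀ j₁ , subst (_≢ 0ℚ) (sym (insertAt-punchIn μ j₀ _ j₁)) μj₁≢0) ,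
    λ c → trans (combination-lift μ c) (rel c)

dependent-of-fewerCoords : ∀ q p → q ℕ.< p → (v : Fin p → Fin q → ℚ) → Dependent v
dependent-of-fewerCoords zero (suc p) _ v = e₀ , (zero , λ ()) , λ ()
  where
  e₀ : Fin (suc p) → ℚ
  e₀ zero    = 1ℚ
  e₀ (suc _) = 0ℚ
dependent-of-fewerCoords (suc q) (suc p) (s≤s q<p) v
  with any? (λ j → ¬? (v j zero ℚP.≟ 0ℚ))
... | yes (j₀ , a≢0) =
  dependent-lift (dependent-dropZeroCoord eliminated zero eliminated-firstCoord
    (dependent-of-fewerCoords q p q<p (λ j c → eliminated j (suc c))))
  where open Elimination v j₀ a≢0
... | no noPivot =
  dependent-dropZeroCoord v zero firstCoord
    (dependent-of-fewerCoords q (suc p) (ℕP.m≤n⇒m≤1+n q<p) (λ j c → v j (suc c)))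
  where
  firstCoord : ∀ j → v j zero ≡ 0ℚ
  firstCoord j with v j zero ℚP.≟ 0ℚ
  ... | yes eq = eq
  ... | no neq = ⊥-elim (noPivot (j , neq))

dependent-of-zeroCoord : ∀ {p} (v : Fin p → Fin p → ℚ) (c₀ : Fin p) →
  (∀ j → v j c₀ ≡ 0ℚ) → Dependent v
dependent-of-zeroCoord {suc p} v c₀ zeroCoord =
  dependent-dropZeroCoord v c₀ zeroCoord
    (dependent-of-fewerCoords p (suc p) ≤-refl (λ j c → v j (punchIn c₀ c)))

Independent : ∀ {p q} → (Fin p → Fin q → ℚ) → Set
Independent v = ∀ l → (∀ c → combination l v c ≡ 0ℚ) → ∀ j → l j ≡ 0ℚ

independent-noZeroCoord : ∀ {p} (v : Fin p → Fin p → ℚ) → Independent v →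
  ∀ c₀ → ¬ (∀ j → v j c₀ ≡ 0ℚ)
independent-noZeroCoord v independent c₀ zeroCoord
  with dependent-of-zeroCoord v c₀ zeroCoord
... | l , (j , l-j≢0) , relation = l-j≢0 (independent l relation j)

⦅_⦆ : ∀ {n} → Fin n → VSet n
⦅ u ⦆ x = does (x ≟ u)

_─_ : ∀ {n} → VSet n → Fin n → VSet n
(S ─ u) x = S x ∧ not (does (x ≟ u))

_∪ᵥ_ : ∀ {n} → VSet n → VSet n → VSet n
(A ∪ᵥ B) x = A x ∨ B x

split-off : ∀ {n} (S : VSet n) {u} → S u ≡ true → ∀ x → S x ≡ (⦅ u ⦆ ∪ᵥ (S ─ u)) x
split-off S {u} u∈S x with x ≟ u
... | yes refl = u∈S
... | no _     = sym (∧-identityʳ (S x))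

⦅⦆-disjoint-─ : ∀ {n} (S : VSet n) u → Disjoint ⦅ u ⦆ (S ─ u)
⦅⦆-disjoint-─ S u x with x ≟ u
... | yes _ = λ { (_ , x∈S─u) → contradiction (trans (sym (∧-zeroʳ (S x))) x∈S─u) λ () }
... | no _  = λ { (() , _) }

Inside : (G : Graph) → VSet (n G) → Fin (m G) → Set
Inside G S e = S (proj₁ (ends G e)) ≡ true × S (proj₂ (ends G e)) ≡ true

χ : Bool → ℚ
χ b = if b then 1ℚ else 0ℚ

χ-xor-∪ : ∀ x y x′ y′ → ¬ (x ≡ true × y ≡ true) → ¬ (x′ ≡ true × y′ ≡ true) →
  ¬ ((x ∨ y) ≡ true × (x′ ∨ y′) ≡ true) →
  χ ((x ∨ y) xor (x′ ∨ y′)) ≡ χ (x xor x′) + χ (y xor y′)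
χ-xor-∪ true  true  _     _     disj _    _      = ⊥-elim (disj (refl , refl))
χ-xor-∪ _     _     true  true  _    disj′ _     = ⊥-elim (disj′ (refl , refl))
χ-xor-∪ true  false true  false _    _    inside = ⊥-elim (inside (refl , refl))
χ-xor-∪ true  false false true  _    _    inside = ⊥-elim (inside (refl , refl))
χ-xor-∪ false true  true  false _    _    inside = ⊥-elim (inside (refl , refl))
χ-xor-∪ false true  false true  _    _    inside = ⊥-elim (inside (refl , refl))
χ-xor-∪ true  false false false _    _    _      = refl
χ-xor-∪ false true  false false _    _    _      = refl
χ-xor-∪ false false true  false _    _    _      = refl
χ-xor-∪ false false false true  _    _    _      = refl
χ-xor-∪ false false false false _    _    _      = refl

χδ-unseparated : (G : Graph) (T : VSet (n G)) (e : Fin (m G)) →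
  T (proj₁ (ends G e)) ≡ T (proj₂ (ends G e)) → χδ G T e ≡ 0ℚ
χδ-unseparated G T e same =
  cong χ (trans (cong (_xor T b) same) (xor-same (T b)))
  where b = proj₂ (ends G e)

cutWeight≡sum : (G : Graph) (c : Fin (m G) → ℚ) (S : VSet (n G)) →
  cutWeight G c S ≡ sum (λ e → c e * χδ G S e)
cutWeight≡sum G c S = Σℚ≡sum (λ e → c e * χδ G S e)

cutWeight-∪ : (G : Graph) (c : Fin (m G) → ℚ) (A B : VSet (n G)) → Disjoint A B →
  (∀ e → ¬ Inside G (A ∪ᵥ B) e) →
  cutWeight G c (A ∪ᵥ B) ≡ cutWeight G c A + cutWeight G c B
cutWeight-∪ G c A B disjoint noInside = begin
  cutWeight G c (A ∪ᵥ B)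
    ≡⟨ cutWeight≡sum G c (A ∪ᵥ B) ⟩
  sum (λ e → c e * χδ G (A ∪ᵥ B) e)
    ≡⟨ sum-cong-≗ (λ e → cong (c e *_) (χ-xor-∪ _ _ _ _ (disjoint _) (disjoint _) (noInside e))) ⟩
  sum (λ e → c e * (χδ G A e + χδ G B e))
    ≡⟨ sum-cong-≗ (λ e → ℚP.*-distribˡ-+ (c e) (χδ G A e) (χδ G B e)) ⟩
  sum (λ e → c e * χδ G A e + c e * χδ G B e)
    ≡⟨ ∑-distrib-+ (λ e → c e * χδ G A e) (λ e → c e * χδ G B e) ⟩
  sum (λ e → c e * χδ G A e) + sum (λ e → c e * χδ G B e)
    ≡⟨ cong₂ _+_ (cutWeight≡sum G c A) (cutWeight≡sum G c B) ⟨
  cutWeight G c A + cutWeight G c B ∎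

cutWeight-cong : (G : Graph) (c : Fin (m G) → ℚ) {S T : VSet (n G)} →
  (∀ x → S x ≡ T x) → cutWeight G c S ≡ cutWeight G c T
cutWeight-cong G c {S} {T} S≗T = begin
  cutWeight G c S                ≡⟨ cutWeight≡sum G c S ⟩
  sum (λ e → c e * χδ G S e)     ≡⟨ sum-cong-≗ (λ e → cong (λ b → c e * χ b)
                                      (cong₂ _xor_ (S≗T (proj₁ (ends G e))) (S≗T (proj₂ (ends G e))))) ⟩
  sum (λ e → c e * χδ G T e)     ≡⟨ cutWeight≡sum G c T ⟨
  cutWeight G c T                ∎

cut∈CUT : (G : Graph) (T : VSet (n G)) → NonTrivial T → InCUT G (χδ G T)
cut∈CUT G T nonTrivial =
  1 , (λ _ → T) , (λ _ → 1ℚ) , (λ _ → nonTrivial) , (λ _ → ℚP.nonNegative⁻¹ 1ℚ) , refl ,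
  λ e → ℚP.≤-reflexive (trans (ℚP.+-identityʳ _) (ℚP.*-identityˡ _))

cutWeight-positive : (G : Graph) (c : Fin (m G) → ℚ) {β : ℚ} → 0ℚ < β →
  (∀ x → InCUT G x → β ≤ℚ dot c x) → ∀ T → NonTrivial T → 0ℚ < cutWeight G c T
cutWeight-positive G c 0<β valid T nonTrivial = ℚP.<-≤-trans 0<β (valid _ (cut∈CUT G T nonTrivial))

ℕtoℚ-positive : ∀ k → 1 ≤ k → 0ℚ < ℕtoℚ k
ℕtoℚ-positive (suc k) _ = ℚP.positive⁻¹ _ {{ℚP.normalize-pos (suc k) 1}}

-- If all cuts have positive weight, a minimum cut S with no edge inside
-- consists of a single node: otherwise S splits into {u} and S - u, and
-- c(δ({u})) < c(δ({u})) + c(δ(S - u)) = c(δ(S)).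
minimumCut-noInside-singleton : (G : Graph) (c : Fin (m G) → ℚ) →
  (∀ T → NonTrivial T → 0ℚ < cutWeight G c T) →
  ∀ {S} → MinimumCut G c S → (∀ e → ¬ Inside G S e) →
  ∀ {u} → S u ≡ true → ∀ w → S w ≡ true → w ≡ u
minimumCut-noInside-singleton G c positive {S} (_ , minimal) noInside {u} u∈S w w∈S
  with w ≟ u
... | yes w≡u = w≡u
... | no w≢u  = ⊥-elim (ℚP.<-irrefl refl (ℚP.<-≤-trans smaller (minimal ⦅ u ⦆ ⦅u⦆-nonTrivial)))
  where
  w∉⦅u⦆ : ⦅ u ⦆ w ≡ false
  w∉⦅u⦆ = dec-false (w ≟ u) w≢u

  ⦅u⦆-nonTrivial : NonTrivial ⦅ u ⦆
  ⦅u⦆-nonTrivial = (u , dec-true (u ≟ u) refl) , (w , w∉⦅u⦆)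

  S─u-nonTrivial : NonTrivial (S ─ u)
  S─u-nonTrivial =
    (w , cong₂ _∧_ w∈S (cong not w∉⦅u⦆)) ,
    (u , trans (cong (λ b → S u ∧ not b) (dec-true (u ≟ u) refl)) (∧-zeroʳ (S u)))

  split : cutWeight G c S ≡ cutWeight G c ⦅ u ⦆ + cutWeight G c (S ─ u)
  split = trans (cutWeight-cong G c (split-off S u∈S))
    (cutWeight-∪ G c ⦅ u ⦆ (S ─ u) (⦅⦆-disjoint-─ S u)
      (λ e inside → noInside e (subst-inside e inside)))
    where
    subst-inside : ∀ e → Inside G (⦅ u ⦆ ∪ᵥ (S ─ u)) e → Inside G S e
    subst-inside e (a , b) = trans (split-off S u∈S _) a , trans (split-off S u∈S _) b

  smaller : cutWeight G c ⦅ u ⦆ < cutWeight G c S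
  smaller = subst₂ _<_ (ℚP.+-identityʳ _) (sym split)
    (ℚP.+-monoʳ-< (cutWeight G c ⦅ u ⦆) (positive (S ─ u) S─u-nonTrivial))

-- In a laminar family every member F j contains the level-0 member F i,
-- avoids it, or is contained in it (and then, F i being minimal, contains
-- it as well); so no member separates two nodes of F i.
levelZero-inseparable : ∀ {n r} {F : Fin r → VSet n} → Laminar F →
  ∀ {i} → LevelZero F i → ∀ {a b} → F i a ≡ true → F i b ≡ true →
  ∀ j → F j a ≡ F j b
levelZero-inseparable {F = F} laminar {i} levelZero {a} {b} a∈Fi b∈Fi j with laminar i j
... | inj₂ (inj₁ Fi⊆Fj) = trans (Fi⊆Fj a a∈Fi) (sym (Fi⊆Fj b b∈Fi))
... | inj₂ (inj₂ Fj⊆Fi) = trans (levelZero j Fj⊆Fi a a∈Fi) (sym (levelZero j Fj⊆Fi b b∈Fi))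
... | inj₁ disjoint     = trans (avoids a∈Fi) (sym (avoids b∈Fi))
  where
  avoids : ∀ {x} → F i x ≡ true → F j x ≡ false
  avoids x∈Fi = ¬-not (λ x∈Fj → disjoint _ (x∈Fi , x∈Fj))

-- The cuts of a basis are linearly independent, so every
-- edge lies in one of them; an edge inside the level-0 set F i would lie
-- in none.  Hence F i has no inner edge, and being a minimum cut while all
-- cuts weigh at least k > 0, it is a single node.
lemma2p8 : (k : ℕ) → 1 ≤ k → (G : Graph) → MinorMinimalNonK G k →
    (c : Fin (m G) → ℚ) → Witness G k c →
    (F : Fin (m G) → VSet (n G)) → Laminar F → BasisOfMinCuts G c F →
    ∀ i → LevelZero F i → Singleton (F i)
lemma2p8 k 1≤k G _ c ((valid , _) , _) F laminar (minimum , basis) i levelZero =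
  u , u∈Fi ,
  minimumCut-noInside-singleton G c positive (minimum i) noInside u∈Fi
  where
  u = proj₁ (proj₁ (proj₁ (minimum i)))
  u∈Fi = proj₂ (proj₁ (proj₁ (minimum i)))

  positive : ∀ T → NonTrivial T → 0ℚ < cutWeight G c T
  positive = cutWeight-positive G c (ℕtoℚ-positive k 1≤k) valid

  independent : Independent (λ j e → χδ G (F j) e)
  independent l rel = basis l (λ e → trans (Σℚ≡sum (λ j → l j * χδ G (F j) e)) (rel e))

  noInside : ∀ e → ¬ Inside G (F i) e
  noInside e (a∈Fi , b∈Fi) =
    independent-noZeroCoord _ independent e
      (λ j → χδ-unseparated G (F j) e (levelZero-inseparable laminar levelZero a∈Fi b∈Fi j))
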